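{- Let $G=(V,E)$ be a finite graph with $n=|V|$ and let $0<p\le 1/2$. For $k\ge 0$ let $\Omega_k$ be the set of subsets $S\subseteq E$ such that exactly $k$ vertices have odd degree in $(V,S)$, and let $Z_k=\sum_{S\in\Omega_k}p^{|S|}(1-p)^{|E\setminus S|}$. Then $$Z_2\le\binom{n}{2}Z_0.$$
   Formalization: The parameter p ranges over the rationals with $0<p\le 1/2$. -}

module Defs where

open import Data.Bool using (Bool; true; false; if_then_else_; _∧_; _∨_)
open import Data.Nat as ℕ using (ℕ; zero; suc)
open import Data.Fin using (Fin; toℕ)
open import Data.Fin.Properties using (_≟_)
open import Data.Product using (_×_; _,_)
open import Data.List using (List; []; _∷_; map; filterᵇ; allFin; cartesianProduct; length; foldr; concatMap)
open import Data.Vec using (Vec; []; _∷_; zipWith; toList)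
open import Data.Rational using (ℚ; 0ℚ; 1ℚ; _+_; _*_; _-_)
open import Relation.Binary.PropositionalEquality using (_≡_)
open import Relation.Nullary.Decidable using (⌊_⌋)

record Graph (n : ℕ) : Set where
  field
    adj    : Fin n → Fin n → Bool
    sym    : ∀ i j → adj i j ≡ adj j i
    irrefl : ∀ i → adj i i ≡ false
open Graph public

edges : ∀ {n} → Graph n → List (Fin n × Fin n)
edges {n} G = filterᵇ (λ { (i , j) → ⌊ toℕ i ℕ.<? toℕ j ⌋ ∧ adj G i j })
                      (cartesianProduct (allFin n) (allFin n))

nEdges : ∀ {n} → Graph n → ℕ
nEdges G = length (edges G)

-- Edge subsets S ⊆ E are represented by their indicator vectors
-- (one Boolean per edge of E, in the order of 'edges G').
EdgeSubset : ∀ {n} → Graph n → Set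
EdgeSubset G = Vec Bool (nEdges G)

allVecs : (m : ℕ) → List (Vec Bool m)
allVecs zero    = [] ∷ []
allVecs (suc m) = concatMap (λ v → (true ∷ v) ∷ (false ∷ v) ∷ []) (allVecs m)

selected : ∀ {n} (G : Graph n) → EdgeSubset G → List (Fin n × Fin n)
selected G S = foldr (λ { (b , e) r → if b then e ∷ r else r }) []
                     (toList (zipWith _,_ S (Data.Vec.fromList (edges G))))

size : ∀ {n} (G : Graph n) → EdgeSubset G → ℕ
size G S = length (selected G S)

degree : ∀ {n} (G : Graph n) → EdgeSubset G → Fin n → ℕ
degree G S v = length (filterᵇ (λ { (i , j) → ⌊ i ≟ v ⌋ ∨ ⌊ j ≟ v ⌋ }) (selected G S))

isOdd : ℕ → Bool
isOdd zero          = false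
isOdd (suc zero)    = true
isOdd (suc (suc k)) = isOdd k

oddCount : ∀ {n} (G : Graph n) → EdgeSubset G → ℕ
oddCount {n} G S = length (filterᵇ (λ v → isOdd (degree G S v)) (allFin n))

Ω : ∀ {n} (G : Graph n) → ℕ → List (EdgeSubset G)
Ω G k = filterᵇ (λ S → ⌊ oddCount G S ℕ.≟ k ⌋) (allVecs (nEdges G))

_^_ : ℚ → ℕ → ℚ
x ^ zero  = 1ℚ
x ^ suc m = x * (x ^ m)

sumℚ : List ℚ → ℚ
sumℚ = foldr _+_ 0ℚ

Z : ∀ {n} (G : Graph n) → ℚ → ℕ → ℚ
Z G p k = sumℚ (map (λ S → (p ^ size G S) * ((1ℚ - p) ^ (nEdges G ℕ.∸ size G S))) (Ω G k))

{-# OPTIONS --safe #-}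
module Submission where

-- Over 𝔽₂ the set ∂S of odd-degree vertices of (V, S) is the sum of the incidence vectors of
-- the edges in S. Hence Z_k is the sum, over the C(n,k) vertex sets a with |a| = k, of the
-- probability that a random edge set (each edge kept independently with probability p) has
-- ∂S = a, and it suffices that for p ≤ 1/2 such a random subset sum of vectors of 𝔽₂ⁿ is at
-- least as likely to be ∅ as to be any other a.
-- This is proved in the stronger form that E_T(a) = E[#T(a ⊕ X)] is maximal at a = ∅ for every
-- list T, where #T(b) counts the sublists of T with sum b and X is the random sum. Without
-- random vectors this holds because the nonempty fibres of the linear map "sublist ↦ sum" all
-- have the same size. One more random vector e turns E_T(a) into
-- p E_T(a ⊕ e) + (1 - p) E_T(a) = (1 - 2p) E_T(a) + p E_{e ∷ T}(a),
-- and both terms are maximal at ∅ by induction.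

open import Algebra.Bundles using (CommutativeMonoid)
open import Data.Bool using (Bool; true; false; if_then_else_; not; _∨_; _xor_)
open import Data.Bool.Properties as Bool using (xor-assoc; xor-comm; xor-identityˡ; if-swap-then)
open import Data.Empty using (⊥-elim)
open import Data.Fin as Fin using (Fin)
import Data.Fin.Properties as Fin
open import Data.Fin.Subset using (Subset; ∣_∣; ∁) renaming (⊥ to ∅)
open import Data.Fin.Subset.Properties using (∣⊥∣≡0; ∣∁p∣≡n∸∣p∣)
import Data.Integer as ℤ
import Data.Integer.Properties as ℤ
open import Data.List as List using (List; []; _∷_; foldr; map; filterᵇ; length; concatMap)
open import Data.Nat as ℕ using (ℕ; zero; suc; z≤n)
import Data.Nat.Properties as ℕ
open import Data.Nat.Combinatorics using (_C_; nCk+nC[k+1]≡[n+1]C[k+1])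
open import Data.Nat.Coprimality using (1-coprimeTo) renaming (sym to coprime-sym)
open import Data.Product using (_×_; _,_)
open import Data.Rational using (ℚ; 0ℚ; 1ℚ; ½; _+_; _*_; _-_; -_; _≤_; _<_; mkℚ; _/_; nonNegative)
open import Data.Rational.Properties as ℚ
  using (+-mono-≤; +-monoˡ-≤; +-monoʳ-≤; *-monoˡ-≤-nonNeg; +-identityˡ; +-identityʳ; +-inverseʳ)
open import Data.Rational.Solver using (module +-*-Solver)
open import Data.Vec as Vec using (Vec; []; _∷_; zipWith; lookup; tabulate)
open import Data.Vec.Properties as Vec
  using (zipWith-assoc; zipWith-comm; zipWith-identityˡ; lookup-zipWith; lookup-replicate; lookup∘tabulate)
open import Function using (_∘_; id)
open import Function.Bundles using (_⇔_; mk⇔)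
open import Relation.Binary.Definitions using (DecidableEquality)
open import Relation.Binary.PropositionalEquality
open import Relation.Nullary using (yes; no)
open import Relation.Nullary.Decidable using (⌊_⌋; does; does-⇔; isYes≗does)

open import Algebra.Properties.CommutativeSemigroup
  (CommutativeMonoid.commutativeSemigroup ℚ.+-0-commutativeMonoid) using (interchange)
open import Algebra.Properties.CommutativeSemigroup
  (CommutativeMonoid.commutativeSemigroup ℚ.*-1-commutativeMonoid)
  using () renaming (x∙yz≈y∙xz to x*[y*z]≡y*[x*z])

open import Defs
  using (Graph; edges; nEdges; EdgeSubset; selected; size; degree; isOdd; oddCount; allVecs; _^_; sumℚ; Z)

private
  variable
    A B : Set
    n : ℕ

-- Symmetric difference

infixl 6 _⊕_
infix  4 _≟_

_⊕_ : Subset n → Subset n → Subset n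
_⊕_ = zipWith _xor_

_≟_ : DecidableEquality (Subset n)
_≟_ = Vec.≡-dec Bool._≟_

⊕-assoc : (a b c : Subset n) → a ⊕ b ⊕ c ≡ a ⊕ (b ⊕ c)
⊕-assoc = zipWith-assoc xor-assoc

⊕-comm : (a b : Subset n) → a ⊕ b ≡ b ⊕ a
⊕-comm = zipWith-comm xor-comm

⊕-identityˡ : (a : Subset n) → ∅ ⊕ a ≡ a
⊕-identityˡ = zipWith-identityˡ xor-identityˡ

⊕-self : (a : Subset n) → a ⊕ a ≡ ∅
⊕-self []          = refl
⊕-self (false ∷ a) = cong (false ∷_) (⊕-self a)
⊕-self (true ∷ a)  = cong (false ∷_) (⊕-self a)

⊕-cancelʳ : (a b : Subset n) → a ⊕ b ⊕ b ≡ a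
⊕-cancelʳ a b = begin
  a ⊕ b ⊕ b   ≡⟨ ⊕-assoc a b b ⟩
  a ⊕ (b ⊕ b) ≡⟨ cong (a ⊕_) (⊕-self b) ⟩
  a ⊕ ∅       ≡⟨ ⊕-comm a ∅ ⟩
  ∅ ⊕ a       ≡⟨ ⊕-identityˡ a ⟩
  a           ∎
  where open ≡-Reasoning

⊕-swapʳ : (a b c : Subset n) → a ⊕ b ⊕ c ≡ a ⊕ c ⊕ b
⊕-swapʳ a b c = begin
  a ⊕ b ⊕ c   ≡⟨ ⊕-assoc a b c ⟩
  a ⊕ (b ⊕ c) ≡⟨ cong (a ⊕_) (⊕-comm b c) ⟩
  a ⊕ (c ⊕ b) ≡⟨ ⊕-assoc a c b ⟨
  a ⊕ c ⊕ b   ∎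
  where open ≡-Reasoning

a⊕e⊕[b⊕e]≡a⊕b : (a b e : Subset n) → a ⊕ e ⊕ (b ⊕ e) ≡ a ⊕ b
a⊕e⊕[b⊕e]≡a⊕b a b e = begin
  a ⊕ e ⊕ (b ⊕ e) ≡⟨ ⊕-assoc (a ⊕ e) b e ⟨
  a ⊕ e ⊕ b ⊕ e   ≡⟨ cong (_⊕ e) (⊕-swapʳ a e b) ⟩
  a ⊕ b ⊕ e ⊕ e   ≡⟨ ⊕-cancelʳ (a ⊕ b) e ⟩
  a ⊕ b           ∎
  where open ≡-Reasoning

x⊕d≡a⇔d≡a⊕x : (x d a : Subset n) → x ⊕ d ≡ a ⇔ d ≡ a ⊕ x
x⊕d≡a⇔d≡a⊕x x d a = mk⇔
  (λ { refl → sym (trans (cong (_⊕ x) (⊕-comm x d)) (⊕-cancelʳ d x)) })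
  (λ { refl → trans (⊕-comm x (a ⊕ x)) (⊕-cancelʳ a x) })

∣a∣≡0⇔∅≡a : (a : Subset n) → ∣ a ∣ ≡ 0 ⇔ ∅ ≡ a
∣a∣≡0⇔∅≡a {n} a = mk⇔ (to a) (λ { refl → ∣⊥∣≡0 n })
  where
  to : {n : ℕ} (a : Subset n) → ∣ a ∣ ≡ 0 → ∅ ≡ a
  to []          _     = refl
  to (false ∷ a) ∣a∣≡0 = cong (false ∷_) (to a ∣a∣≡0)

⨁ : List (Subset n) → Subset n
⨁ = foldr _⊕_ ∅

-- Counting subset sums

#sums : List (Subset n) → Subset n → ℕ
#sums []      a = if does (∅ ≟ a) then 1 else 0
#sums (e ∷ T) a = #sums T a ℕ.+ #sums T (a ⊕ e)

#sums[]≢0⇒∅≡ : {a : Subset n} → #sums [] a ≢ 0 → ∅ ≡ a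
#sums[]≢0⇒∅≡ {a = a} hit with ∅ ≟ a
... | yes ∅≡a = ∅≡a
... | no  _   = ⊥-elim (hit refl)

#sums-translate : (T : List (Subset n)) {a : Subset n} (b : Subset n) →
                  #sums T a ≢ 0 → #sums T (a ⊕ b) ≡ #sums T b
#sums-translate []      {a} b a-hit =
  trans (cong (λ c → #sums [] (c ⊕ b)) (sym (#sums[]≢0⇒∅≡ {a = a} a-hit)))
        (cong (#sums []) (⊕-identityˡ b))
#sums-translate (e ∷ T) {a} b a-hit with #sums T a ℕ.≟ 0
... | no a-hitᵀ = cong₂ ℕ._+_
  (#sums-translate T b a-hitᵀ)
  (trans (cong (#sums T) (⊕-assoc a b e)) (#sums-translate T (b ⊕ e) a-hitᵀ))
... | yes a-missᵀ = begin
  #sums T (a ⊕ b) ℕ.+ #sums T (a ⊕ b ⊕ e)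
    ≡⟨ cong₂ (λ x y → #sums T x ℕ.+ #sums T y) (sym (a⊕e⊕[b⊕e]≡a⊕b a b e)) (⊕-swapʳ a b e) ⟩
  #sums T (a ⊕ e ⊕ (b ⊕ e)) ℕ.+ #sums T (a ⊕ e ⊕ b)
    ≡⟨ cong₂ ℕ._+_ (#sums-translate T (b ⊕ e) a⊕e-hitᵀ) (#sums-translate T b a⊕e-hitᵀ) ⟩
  #sums T (b ⊕ e) ℕ.+ #sums T b
    ≡⟨ ℕ.+-comm (#sums T (b ⊕ e)) (#sums T b) ⟩
  #sums T b ℕ.+ #sums T (b ⊕ e) ∎
  where
  open ≡-Reasoning
  a⊕e-hitᵀ : #sums T (a ⊕ e) ≢ 0
  a⊕e-hitᵀ a⊕e-missᵀ = a-hit (cong₂ ℕ._+_ a-missᵀ a⊕e-missᵀ)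

#sums≤#sums∅ : (T : List (Subset n)) (a : Subset n) → #sums T a ℕ.≤ #sums T ∅
#sums≤#sums∅ T a with #sums T a ℕ.≟ 0
... | yes a-miss rewrite a-miss = z≤n
... | no  a-hit  = ℕ.≤-reflexive (begin
  #sums T a       ≡⟨ #sums-translate T a a-hit ⟨
  #sums T (a ⊕ a) ≡⟨ cong (#sums T) (⊕-self a) ⟩
  #sums T ∅       ∎)
  where open ≡-Reasoning

-- Finite sums

fromℕ : ℕ → ℚ
fromℕ k = ℤ.+ k / 1

fromℕ-+ : ∀ a b → fromℕ (a ℕ.+ b) ≡ fromℕ a + fromℕ b
fromℕ-+ a b = begin
  ℤ.+ (a ℕ.+ b) / 1
    ≡⟨ cong₂ (λ x y → (x ℤ.+ y) / 1) (ℤ.*-identityʳ (ℤ.+ a)) (ℤ.*-identityʳ (ℤ.+ b)) ⟨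
  (ℤ.+ a ℤ.* ℤ.+ 1 ℤ.+ ℤ.+ b ℤ.* ℤ.+ 1) / 1
    ≡⟨ cong₂ _+_ (fromℕ≡mkℚ a) (fromℕ≡mkℚ b) ⟨
  fromℕ a + fromℕ b ∎
  where
  open ≡-Reasoning
  fromℕ≡mkℚ : ∀ k → fromℕ k ≡ mkℚ (ℤ.+ k) 0 (coprime-sym (1-coprimeTo k))
  fromℕ≡mkℚ k = ℚ.normalize-coprime (coprime-sym (1-coprimeTo k))

0≤fromℕ : ∀ k → 0ℚ ≤ fromℕ k
0≤fromℕ k = ℚ.nonNegative⁻¹ (fromℕ k) {{ℚ.normalize-nonNeg k 1}}

fromℕ-mono-≤ : ∀ {a b} → a ℕ.≤ b → fromℕ a ≤ fromℕ b
fromℕ-mono-≤ {a} {b} a≤b = begin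
  fromℕ a                   ≡⟨ +-identityʳ (fromℕ a) ⟨
  fromℕ a + 0ℚ              ≤⟨ +-monoʳ-≤ (fromℕ a) (0≤fromℕ (b ℕ.∸ a)) ⟩
  fromℕ a + fromℕ (b ℕ.∸ a) ≡⟨ fromℕ-+ a (b ℕ.∸ a) ⟨
  fromℕ (a ℕ.+ (b ℕ.∸ a))   ≡⟨ cong fromℕ (ℕ.m+[n∸m]≡n a≤b) ⟩
  fromℕ b                   ∎
  where open ℚ.≤-Reasoning

∑ : List A → (A → ℚ) → ℚ
∑ xs f = sumℚ (map f xs)

syntax ∑ xs (λ x → e) = ∑[ x ← xs ] e

∑-cong : {f g : A → ℚ} → (∀ x → f x ≡ g x) → (xs : List A) → ∑ xs f ≡ ∑ xs g
∑-cong f≗g []       = refl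
∑-cong f≗g (x ∷ xs) = cong₂ _+_ (f≗g x) (∑-cong f≗g xs)

∑-mono-≤ : {f g : A → ℚ} → (∀ x → f x ≤ g x) → (xs : List A) → ∑ xs f ≤ ∑ xs g
∑-mono-≤ f≤g []       = ℚ.≤-refl
∑-mono-≤ f≤g (x ∷ xs) = +-mono-≤ (f≤g x) (∑-mono-≤ f≤g xs)

∑-zero : (xs : List A) → ∑[ x ← xs ] 0ℚ ≡ 0ℚ
∑-zero []       = refl
∑-zero (x ∷ xs) = trans (+-identityˡ _) (∑-zero xs)

∑-distrib-+ : (f g : A → ℚ) (xs : List A) → ∑[ x ← xs ] (f x + g x) ≡ ∑ xs f + ∑ xs g
∑-distrib-+ f g []       = refl
∑-distrib-+ f g (x ∷ xs) = trans (cong ((f x + g x) +_) (∑-distrib-+ f g xs))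
                                 (interchange (f x) (g x) (∑ xs f) (∑ xs g))

*-distribˡ-∑ : (c : ℚ) (f : A → ℚ) (xs : List A) → ∑[ x ← xs ] (c * f x) ≡ c * ∑ xs f
*-distribˡ-∑ c f []       = sym (ℚ.*-zeroʳ c)
*-distribˡ-∑ c f (x ∷ xs) = trans (cong (c * f x +_) (*-distribˡ-∑ c f xs))
                                  (sym (ℚ.*-distribˡ-+ c (f x) (∑ xs f)))

∑-comm : (f : A → B → ℚ) (xs : List A) (ys : List B) →
         ∑[ x ← xs ] ∑[ y ← ys ] f x y ≡ ∑[ y ← ys ] ∑[ x ← xs ] f x y
∑-comm f []       ys = sym (∑-zero ys)
∑-comm f (x ∷ xs) ys = trans (cong (∑ ys (f x) +_) (∑-comm f xs ys)) (sym (∑-distrib-+ (f x) _ ys))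

∑-if : (b : Bool) (f : A → ℚ) (xs : List A) →
       ∑[ x ← xs ] (if b then f x else 0ℚ) ≡ (if b then ∑ xs f else 0ℚ)
∑-if true  f xs = refl
∑-if false f xs = ∑-zero xs

∑-filterᵇ : (P : A → Bool) (f : A → ℚ) (xs : List A) →
            ∑ (filterᵇ P xs) f ≡ ∑[ x ← xs ] (if P x then f x else 0ℚ)
∑-filterᵇ P f []       = refl
∑-filterᵇ P f (x ∷ xs) with P x
... | true  = cong (f x +_) (∑-filterᵇ P f xs)
... | false = trans (∑-filterᵇ P f xs) (sym (+-identityˡ _))

*-if : (c : ℚ) (b : Bool) (x : ℚ) → c * (if b then x else 0ℚ) ≡ (if b then c * x else 0ℚ)
*-if c true  x = refl
*-if c false x = ℚ.*-zeroʳ c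

if-mono-≤ : (b : Bool) {x y : ℚ} → x ≤ y → (if b then x else 0ℚ) ≤ (if b then y else 0ℚ)
if-mono-≤ true  x≤y = x≤y
if-mono-≤ false _   = ℚ.≤-refl

∑-allVecs-suc : (m : ℕ) (f : Subset (suc m) → ℚ) →
                ∑ (allVecs (suc m)) f ≡ ∑[ v ← allVecs m ] (f (true ∷ v) + f (false ∷ v))
∑-allVecs-suc m f = go (allVecs m)
  where
  go : (vs : List (Subset m)) →
       ∑ (concatMap (λ v → (true ∷ v) ∷ (false ∷ v) ∷ []) vs) f ≡
       ∑[ v ← vs ] (f (true ∷ v) + f (false ∷ v))
  go []       = refl
  go (v ∷ vs) = trans (sym (ℚ.+-assoc (f (true ∷ v)) (f (false ∷ v)) _))
                      (cong ((f (true ∷ v) + f (false ∷ v)) +_) (go vs))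

∑-allVecs-≟ : (x : Subset n) (f : Subset n → ℚ) →
              ∑[ a ← allVecs n ] (if does (x ≟ a) then f a else 0ℚ) ≡ f x
∑-allVecs-≟ []                  f = +-identityʳ (f [])
∑-allVecs-≟ {suc n} (true ∷ x)  f = begin
  ∑[ a ← allVecs (suc n) ] (if does (true ∷ x ≟ a) then f a else 0ℚ)
    ≡⟨ ∑-allVecs-suc n _ ⟩
  ∑[ v ← allVecs n ] ((if does (x ≟ v) then f (true ∷ v) else 0ℚ) + 0ℚ)
    ≡⟨ ∑-cong (λ v → +-identityʳ _) (allVecs n) ⟩
  ∑[ v ← allVecs n ] (if does (x ≟ v) then f (true ∷ v) else 0ℚ)
    ≡⟨ ∑-allVecs-≟ x (f ∘ (true ∷_)) ⟩
  f (true ∷ x) ∎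
  where open ≡-Reasoning
∑-allVecs-≟ {suc n} (false ∷ x) f = begin
  ∑[ a ← allVecs (suc n) ] (if does (false ∷ x ≟ a) then f a else 0ℚ)
    ≡⟨ ∑-allVecs-suc n _ ⟩
  ∑[ v ← allVecs n ] (0ℚ + (if does (x ≟ v) then f (false ∷ v) else 0ℚ))
    ≡⟨ ∑-cong (λ v → +-identityˡ _) (allVecs n) ⟩
  ∑[ v ← allVecs n ] (if does (x ≟ v) then f (false ∷ v) else 0ℚ)
    ≡⟨ ∑-allVecs-≟ x (f ∘ (false ∷_)) ⟩
  f (false ∷ x) ∎
  where open ≡-Reasoning

∑-allVecs-∣∣≡ : (n k : ℕ) (c : ℚ) →
                ∑[ a ← allVecs n ] (if does (∣ a ∣ ℕ.≟ k) then c else 0ℚ) ≡ fromℕ (n C k) * c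
∑-allVecs-∣∣≡ zero    zero    c = trans (+-identityʳ c) (sym (ℚ.*-identityˡ c))
∑-allVecs-∣∣≡ zero    (suc k) c = sym (ℚ.*-zeroˡ c)
∑-allVecs-∣∣≡ (suc n) zero    c = begin
  ∑[ a ← allVecs (suc n) ] (if does (∣ a ∣ ℕ.≟ 0) then c else 0ℚ)
    ≡⟨ ∑-allVecs-suc n _ ⟩
  ∑[ v ← allVecs n ] (0ℚ + (if does (∣ v ∣ ℕ.≟ 0) then c else 0ℚ))
    ≡⟨ ∑-cong (λ v → +-identityˡ _) (allVecs n) ⟩
  ∑[ v ← allVecs n ] (if does (∣ v ∣ ℕ.≟ 0) then c else 0ℚ)
    ≡⟨ ∑-allVecs-∣∣≡ n zero c ⟩
  fromℕ (suc n C 0) * c ∎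
  where open ≡-Reasoning
∑-allVecs-∣∣≡ (suc n) (suc k) c = begin
  ∑[ a ← allVecs (suc n) ] c[ ∣ a ∣ ≟ suc k ]
    ≡⟨ ∑-allVecs-suc n _ ⟩
  ∑[ v ← allVecs n ] (c[ ∣ v ∣ ≟ k ] + c[ ∣ v ∣ ≟ suc k ])
    ≡⟨ ∑-distrib-+ (λ v → c[ ∣ v ∣ ≟ k ]) (λ v → c[ ∣ v ∣ ≟ suc k ]) (allVecs n) ⟩
  ∑[ v ← allVecs n ] c[ ∣ v ∣ ≟ k ] + ∑[ v ← allVecs n ] c[ ∣ v ∣ ≟ suc k ]
    ≡⟨ cong₂ _+_ (∑-allVecs-∣∣≡ n k c) (∑-allVecs-∣∣≡ n (suc k) c) ⟩
  fromℕ (n C k) * c + fromℕ (n C suc k) * c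
    ≡⟨ ℚ.*-distribʳ-+ c (fromℕ (n C k)) (fromℕ (n C suc k)) ⟨
  (fromℕ (n C k) + fromℕ (n C suc k)) * c
    ≡⟨ cong (_* c) (fromℕ-+ (n C k) (n C suc k)) ⟨
  fromℕ (n C k ℕ.+ n C suc k) * c
    ≡⟨ cong (λ m → fromℕ m * c) (nCk+nC[k+1]≡[n+1]C[k+1] n k) ⟩
  fromℕ (suc n C suc k) * c ∎
  where
  open ≡-Reasoning
  c[_≟_] : ℕ → ℕ → ℚ
  c[ i ≟ j ] = if does (i ℕ.≟ j) then c else 0ℚ

∑-partition : (g : A → Subset n) (P : Subset n → Bool) (w : A → ℚ) (xs : List A) →
              ∑[ x ← xs ] (if P (g x) then w x else 0ℚ) ≡
              ∑[ a ← allVecs n ] (if P a then ∑[ x ← xs ] (if does (g x ≟ a) then w x else 0ℚ) else 0ℚ)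
∑-partition {n = n} g P w xs = begin
  ∑[ x ← xs ] (if P (g x) then w x else 0ℚ)
    ≡⟨ ∑-cong (λ x → sym (∑-allVecs-≟ (g x) (λ a → if P a then w x else 0ℚ))) xs ⟩
  ∑[ x ← xs ] ∑[ a ← allVecs n ] (if does (g x ≟ a) then (if P a then w x else 0ℚ) else 0ℚ)
    ≡⟨ ∑-comm (λ x a → if does (g x ≟ a) then (if P a then w x else 0ℚ) else 0ℚ) xs (allVecs n) ⟩
  ∑[ a ← allVecs n ] ∑[ x ← xs ] (if does (g x ≟ a) then (if P a then w x else 0ℚ) else 0ℚ)
    ≡⟨ ∑-cong (λ a → trans (∑-cong (λ x → if-swap-then (does (g x ≟ a)) (P a)) xs)
                           (∑-if (P a) (λ x → if does (g x ≟ a) then w x else 0ℚ) xs)) (allVecs n) ⟩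
  ∑[ a ← allVecs n ] (if P a then ∑[ x ← xs ] (if does (g x ≟ a) then w x else 0ℚ) else 0ℚ) ∎
  where open ≡-Reasoning

-- Random subset sums

select : (xs : List A) → Vec Bool (length xs) → List A
select []       []      = []
select (x ∷ xs) (b ∷ s) = if b then x ∷ select xs s else select xs s

length-select : (xs : List A) (s : Vec Bool (length xs)) → length (select xs s) ≡ ∣ s ∣
length-select []       []          = refl
length-select (x ∷ xs) (true ∷ s)  = cong suc (length-select xs s)
length-select (x ∷ xs) (false ∷ s) = length-select xs s

p≤½⇒0≤1-2p : ∀ {p} → p ≤ ½ → 0ℚ ≤ 1ℚ - (p + p)
p≤½⇒0≤1-2p {p} p≤½ = begin
  0ℚ                ≡⟨ +-inverseʳ (p + p) ⟨
  (p + p) - (p + p) ≤⟨ +-monoˡ-≤ (- (p + p)) (+-mono-≤ p≤½ p≤½) ⟩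
  1ℚ - (p + p)      ∎
  where open ℚ.≤-Reasoning

module _ (p : ℚ) where

  -- E[#sums T (a ⊕ X)], where X is the sum of a random sublist of L that keeps each entry
  -- independently with probability p.
  expected#sums : List (Subset n) → List (Subset n) → Subset n → ℚ
  expected#sums []      T a = fromℕ (#sums T a)
  expected#sums (e ∷ L) T a = p * expected#sums L T (a ⊕ e) + (1ℚ - p) * expected#sums L T a

  expected#sums-absorb : (L T : List (Subset n)) (a e : Subset n) →
                         expected#sums L T a + expected#sums L T (a ⊕ e) ≡ expected#sums L (e ∷ T) a
  expected#sums-absorb []       T a e = sym (fromℕ-+ (#sums T a) (#sums T (a ⊕ e)))
  expected#sums-absorb (e′ ∷ L) T a e = begin
    (p * E (a ⊕ e′) + (1ℚ - p) * E a) + (p * E (a ⊕ e ⊕ e′) + (1ℚ - p) * E (a ⊕ e))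
      ≡⟨ cong (λ x → (p * E (a ⊕ e′) + (1ℚ - p) * E a) + (p * E x + (1ℚ - p) * E (a ⊕ e)))
              (⊕-swapʳ a e e′) ⟩
    (p * E (a ⊕ e′) + (1ℚ - p) * E a) + (p * E (a ⊕ e′ ⊕ e) + (1ℚ - p) * E (a ⊕ e))
      ≡⟨ interchange (p * E (a ⊕ e′)) ((1ℚ - p) * E a) (p * E (a ⊕ e′ ⊕ e)) ((1ℚ - p) * E (a ⊕ e)) ⟩
    (p * E (a ⊕ e′) + p * E (a ⊕ e′ ⊕ e)) + ((1ℚ - p) * E a + (1ℚ - p) * E (a ⊕ e))
      ≡⟨ cong₂ _+_ (ℚ.*-distribˡ-+ p _ _) (ℚ.*-distribˡ-+ (1ℚ - p) _ _) ⟨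
    p * (E (a ⊕ e′) + E (a ⊕ e′ ⊕ e)) + (1ℚ - p) * (E a + E (a ⊕ e))
      ≡⟨ cong₂ (λ x y → p * x + (1ℚ - p) * y)
               (expected#sums-absorb L T (a ⊕ e′) e) (expected#sums-absorb L T a e) ⟩
    p * expected#sums L (e ∷ T) (a ⊕ e′) + (1ℚ - p) * expected#sums L (e ∷ T) a ∎
    where
    open ≡-Reasoning
    E : Subset _ → ℚ
    E = expected#sums L T

  expected#sums≤expected#sums∅ : 0ℚ ≤ p → p ≤ ½ → (L T : List (Subset n)) (a : Subset n) →
                                 expected#sums L T a ≤ expected#sums L T ∅
  expected#sums≤expected#sums∅ 0≤p p≤½ []      T a = fromℕ-mono-≤ (#sums≤#sums∅ T a)
  expected#sums≤expected#sums∅ 0≤p p≤½ (e ∷ L) T a = begin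
    p * E (a ⊕ e) + (1ℚ - p) * E a    ≡⟨ mix (E (a ⊕ e)) (E a) ⟩
    r * E a + p * (E a + E (a ⊕ e))   ≡⟨ cong (λ x → r * E a + p * x) (expected#sums-absorb L T a e) ⟩
    r * E a + p * E′ a                ≤⟨ +-mono-≤ (*-monoˡ-≤-nonNeg r {{nonNegative 0≤r}} (IH T a))
                                                  (*-monoˡ-≤-nonNeg p {{nonNegative 0≤p}} (IH (e ∷ T) a)) ⟩
    r * E ∅ + p * E′ ∅                ≡⟨ cong (λ x → r * E ∅ + p * x) (expected#sums-absorb L T ∅ e) ⟨
    r * E ∅ + p * (E ∅ + E (∅ ⊕ e))   ≡⟨ mix (E (∅ ⊕ e)) (E ∅) ⟨
    p * E (∅ ⊕ e) + (1ℚ - p) * E ∅    ∎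
    where
    open ℚ.≤-Reasoning
    open +-*-Solver using (solve; _:+_; _:*_; _:-_; _:=_; con)
    E E′ : Subset _ → ℚ
    E  = expected#sums L T
    E′ = expected#sums L (e ∷ T)
    IH : (T : List (Subset _)) (a : Subset _) → expected#sums L T a ≤ expected#sums L T ∅
    IH = expected#sums≤expected#sums∅ 0≤p p≤½ L
    r : ℚ
    r = 1ℚ - (p + p)
    0≤r : 0ℚ ≤ r
    0≤r = p≤½⇒0≤1-2p p≤½
    mix : ∀ x y → p * x + (1ℚ - p) * y ≡ r * y + p * (y + x)
    mix = solve 3 (λ p x y → p :* x :+ (con 1ℚ :- p) :* y := (con 1ℚ :- (p :+ p)) :* y :+ p :* (y :+ x)) refl p

  weight : {m : ℕ} → Subset m → ℚ
  weight s = p ^ ∣ s ∣ * (1ℚ - p) ^ ∣ ∁ s ∣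

  subsetSumProb : (f : A → Subset n) (xs : List A) → Subset n → ℚ
  subsetSumProb f xs a =
    ∑[ s ← allVecs (length xs) ] (if does (⨁ (map f (select xs s)) ≟ a) then weight s else 0ℚ)

  subsetSumProb-∷ : (f : A → Subset n) (x : A) (xs : List A) (a : Subset n) →
                    subsetSumProb f (x ∷ xs) a ≡
                    p * subsetSumProb f xs (a ⊕ f x) + (1ℚ - p) * subsetSumProb f xs a
  subsetSumProb-∷ f x xs a = begin
    subsetSumProb f (x ∷ xs) a
      ≡⟨ ∑-allVecs-suc (length xs) _ ⟩
    ∑[ s ← Ss ] ((if does (f x ⊕ σ s ≟ a) then weight (true ∷ s) else 0ℚ)
                 + (if does (σ s ≟ a) then weight (false ∷ s) else 0ℚ))
      ≡⟨ ∑-cong (λ s → cong₂ _+_ (kept s) (dropped s)) Ss ⟩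
    ∑[ s ← Ss ] (p * G (a ⊕ f x) s + (1ℚ - p) * G a s)
      ≡⟨ ∑-distrib-+ (λ s → p * G (a ⊕ f x) s) (λ s → (1ℚ - p) * G a s) Ss ⟩
    ∑[ s ← Ss ] (p * G (a ⊕ f x) s) + ∑[ s ← Ss ] ((1ℚ - p) * G a s)
      ≡⟨ cong₂ _+_ (*-distribˡ-∑ p (G (a ⊕ f x)) Ss) (*-distribˡ-∑ (1ℚ - p) (G a) Ss) ⟩
    p * subsetSumProb f xs (a ⊕ f x) + (1ℚ - p) * subsetSumProb f xs a ∎
    where
    open ≡-Reasoning
    Ss : List (Vec Bool (length xs))
    Ss = allVecs (length xs)
    σ : Vec Bool (length xs) → Subset _
    σ s = ⨁ (map f (select xs s))
    G : Subset _ → Vec Bool (length xs) → ℚ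
    G b s = if does (σ s ≟ b) then weight s else 0ℚ
    kept : ∀ s → (if does (f x ⊕ σ s ≟ a) then weight (true ∷ s) else 0ℚ) ≡ p * G (a ⊕ f x) s
    kept s = begin
      (if does (f x ⊕ σ s ≟ a) then p * p ^ ∣ s ∣ * (1ℚ - p) ^ ∣ ∁ s ∣ else 0ℚ)
        ≡⟨ cong₂ (λ b w → if b then w else 0ℚ)
                 (does-⇔ (x⊕d≡a⇔d≡a⊕x (f x) (σ s) a) (f x ⊕ σ s ≟ a) (σ s ≟ a ⊕ f x))
                 (ℚ.*-assoc p _ _) ⟩
      (if does (σ s ≟ a ⊕ f x) then p * weight s else 0ℚ)
        ≡⟨ *-if p _ (weight s) ⟨
      p * G (a ⊕ f x) s ∎
    dropped : ∀ s → (if does (σ s ≟ a) then weight (false ∷ s) else 0ℚ) ≡ (1ℚ - p) * G a s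
    dropped s = trans (cong (λ w → if does (σ s ≟ a) then w else 0ℚ)
                            (x*[y*z]≡y*[x*z] (p ^ ∣ s ∣) (1ℚ - p) ((1ℚ - p) ^ ∣ ∁ s ∣)))
                      (sym (*-if (1ℚ - p) _ (weight s)))

  subsetSumProb≡expected#sums : (f : A → Subset n) (xs : List A) (a : Subset n) →
                                subsetSumProb f xs a ≡ expected#sums (map f xs) [] a
  subsetSumProb≡expected#sums f []       a with ∅ ≟ a
  ... | yes _ = refl
  ... | no  _ = refl
  subsetSumProb≡expected#sums f (x ∷ xs) a = trans (subsetSumProb-∷ f x xs a)
    (cong₂ (λ u v → p * u + (1ℚ - p) * v)
           (subsetSumProb≡expected#sums f xs (a ⊕ f x)) (subsetSumProb≡expected#sums f xs a))

  subsetSumProb≤subsetSumProb∅ : 0ℚ ≤ p → p ≤ ½ → (f : A → Subset n) (xs : List A) (a : Subset n) →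
                                 subsetSumProb f xs a ≤ subsetSumProb f xs ∅
  subsetSumProb≤subsetSumProb∅ 0≤p p≤½ f xs a =
    subst₂ _≤_ (sym (subsetSumProb≡expected#sums f xs a)) (sym (subsetSumProb≡expected#sums f xs ∅))
           (expected#sums≤expected#sums∅ 0≤p p≤½ (map f xs) [] a)

-- Odd-degree vertices

isOdd-suc : (k : ℕ) → isOdd (suc k) ≡ not (isOdd k)
isOdd-suc zero          = refl
isOdd-suc (suc zero)    = refl
isOdd-suc (suc (suc k)) = isOdd-suc k

isOdd-#filterᵇ-∷ : (P : A → Bool) (x : A) (xs : List A) →
                   isOdd (length (filterᵇ P (x ∷ xs))) ≡ P x xor isOdd (length (filterᵇ P xs))
isOdd-#filterᵇ-∷ P x xs with P x
... | true  = isOdd-suc (length (filterᵇ P xs))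
... | false = refl

isOdd-#filterᵇ : (P : A → Bool) (f : A → Subset n) (v : Fin n) → (∀ x → P x ≡ lookup (f x) v) →
                 (xs : List A) → isOdd (length (filterᵇ P xs)) ≡ lookup (⨁ (map f xs)) v
isOdd-#filterᵇ P f v P≗f[v] []       = sym (lookup-replicate v false)
isOdd-#filterᵇ P f v P≗f[v] (x ∷ xs) = begin
  isOdd (length (filterᵇ P (x ∷ xs)))         ≡⟨ isOdd-#filterᵇ-∷ P x xs ⟩
  P x xor isOdd (length (filterᵇ P xs))       ≡⟨ cong₂ _xor_ (P≗f[v] x) (isOdd-#filterᵇ P f v P≗f[v] xs) ⟩
  lookup (f x) v xor lookup (⨁ (map f xs)) v  ≡⟨ lookup-zipWith _xor_ v (f x) (⨁ (map f xs)) ⟨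
  lookup (⨁ (map f (x ∷ xs))) v               ∎
  where open ≡-Reasoning

#filterᵇ-tabulate : (P : A → Bool) (g : Fin n → A) (a : Subset n) → (∀ v → P (g v) ≡ lookup a v) →
                    length (filterᵇ P (List.tabulate g)) ≡ ∣ a ∣
#filterᵇ-tabulate P g []          P∘g≗a = refl
#filterᵇ-tabulate P g (true ∷ a)  P∘g≗a rewrite P∘g≗a Fin.zero =
  cong suc (#filterᵇ-tabulate P (g ∘ Fin.suc) a (P∘g≗a ∘ Fin.suc))
#filterᵇ-tabulate P g (false ∷ a) P∘g≗a rewrite P∘g≗a Fin.zero =
  #filterᵇ-tabulate P (g ∘ Fin.suc) a (P∘g≗a ∘ Fin.suc)

foldr-zip≡select : {f : Bool × A → List A → List A} →
                   (∀ b x r → f (b , x) r ≡ (if b then x ∷ r else r)) →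
                   (xs : List A) (s : Vec Bool (length xs)) →
                   foldr f [] (Vec.toList (zipWith _,_ s (Vec.fromList xs))) ≡ select xs s
foldr-zip≡select f≗ []       []      = refl
foldr-zip≡select f≗ (x ∷ xs) (b ∷ s) =
  trans (f≗ b x _) (cong (λ r → if b then x ∷ r else r) (foldr-zip≡select f≗ xs s))

incidence : Fin n × Fin n → Subset n
incidence (i , j) = tabulate (λ v → ⌊ i Fin.≟ v ⌋ ∨ ⌊ j Fin.≟ v ⌋)

module _ (G : Graph n) where

  ∂ : EdgeSubset G → Subset n
  ∂ S = ⨁ (map incidence (select (edges G) S))

  selected≡select : (S : EdgeSubset G) → selected G S ≡ select (edges G) S
  selected≡select = foldr-zip≡select (λ _ _ _ → refl) (edges G)

  size≡∣S∣ : (S : EdgeSubset G) → size G S ≡ ∣ S ∣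
  size≡∣S∣ S = trans (cong length (selected≡select S)) (length-select (edges G) S)

  oddCount≡∣∂∣ : (S : EdgeSubset G) → oddCount G S ≡ ∣ ∂ S ∣
  oddCount≡∣∂∣ S = #filterᵇ-tabulate _ id (∂ S) isOdd-degree
    where
    isOdd-degree : ∀ v → isOdd (degree G S v) ≡ lookup (∂ S) v
    isOdd-degree v = begin
      isOdd (degree G S v)
        ≡⟨ isOdd-#filterᵇ _ incidence v (λ { (i , j) → sym (lookup∘tabulate _ v) }) (selected G S) ⟩
      lookup (⨁ (map incidence (selected G S))) v
        ≡⟨ cong (λ es → lookup (⨁ (map incidence es)) v) (selected≡select S) ⟩
      lookup (∂ S) v ∎
      where open ≡-Reasoning

  Z≡∑-boundary : (p : ℚ) (k : ℕ) →
                 Z G p k ≡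
                 ∑[ a ← allVecs n ] (if does (∣ a ∣ ℕ.≟ k) then subsetSumProb p incidence (edges G) a else 0ℚ)
  Z≡∑-boundary p k = begin
    Z G p k
      ≡⟨ ∑-filterᵇ _ _ Ss ⟩
    ∑[ S ← Ss ] (if ⌊ oddCount G S ℕ.≟ k ⌋ then p ^ size G S * (1ℚ - p) ^ (nEdges G ℕ.∸ size G S) else 0ℚ)
      ≡⟨ ∑-cong (λ S → cong₂ (λ b w → if b then w else 0ℚ) (oddCount-test S) (weight-of S)) Ss ⟩
    ∑[ S ← Ss ] (if does (∣ ∂ S ∣ ℕ.≟ k) then weight p S else 0ℚ)
      ≡⟨ ∑-partition ∂ (λ a → does (∣ a ∣ ℕ.≟ k)) (weight p) Ss ⟩
    ∑[ a ← allVecs n ] (if does (∣ a ∣ ℕ.≟ k) then subsetSumProb p incidence (edges G) a else 0ℚ) ∎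
    where
    open ≡-Reasoning
    Ss : List (EdgeSubset G)
    Ss = allVecs (nEdges G)
    oddCount-test : (S : EdgeSubset G) → ⌊ oddCount G S ℕ.≟ k ⌋ ≡ does (∣ ∂ S ∣ ℕ.≟ k)
    oddCount-test S = trans (isYes≗does _) (cong (λ c → does (c ℕ.≟ k)) (oddCount≡∣∂∣ S))
    weight-of : (S : EdgeSubset G) → p ^ size G S * (1ℚ - p) ^ (nEdges G ℕ.∸ size G S) ≡ weight p S
    weight-of S = cong₂ (λ i j → p ^ i * (1ℚ - p) ^ j) (size≡∣S∣ S)
                        (trans (cong (nEdges G ℕ.∸_) (size≡∣S∣ S)) (sym (∣∁p∣≡n∸∣p∣ S)))

  Z₀≡subsetSumProb∅ : (p : ℚ) → Z G p 0 ≡ subsetSumProb p incidence (edges G) ∅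
  Z₀≡subsetSumProb∅ p = begin
    Z G p 0
      ≡⟨ Z≡∑-boundary p 0 ⟩
    ∑[ a ← allVecs n ] (if does (∣ a ∣ ℕ.≟ 0) then P a else 0ℚ)
      ≡⟨ ∑-cong (λ a → cong (λ b → if b then P a else 0ℚ)
                            (does-⇔ (∣a∣≡0⇔∅≡a a) (∣ a ∣ ℕ.≟ 0) (∅ ≟ a))) (allVecs n) ⟩
    ∑[ a ← allVecs n ] (if does (∅ ≟ a) then P a else 0ℚ)
      ≡⟨ ∑-allVecs-≟ ∅ P ⟩
    P ∅ ∎
    where
    open ≡-Reasoning
    P : Subset n → ℚ
    P = subsetSumProb p incidence (edges G)

Z≤nCk*Z₀ : (n : ℕ) (G : Graph n) (p : ℚ) → 0ℚ ≤ p → p ≤ ½ →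
           (k : ℕ) → Z G p k ≤ fromℕ (n C k) * Z G p 0
Z≤nCk*Z₀ n G p 0≤p p≤½ k = begin
  Z G p k
    ≡⟨ Z≡∑-boundary G p k ⟩
  ∑[ a ← allVecs n ] (if does (∣ a ∣ ℕ.≟ k) then P a else 0ℚ)
    ≤⟨ ∑-mono-≤ (λ a → if-mono-≤ _ (P≤P∅ a)) (allVecs n) ⟩
  ∑[ a ← allVecs n ] (if does (∣ a ∣ ℕ.≟ k) then P ∅ else 0ℚ)
    ≡⟨ ∑-allVecs-∣∣≡ n k (P ∅) ⟩
  fromℕ (n C k) * P ∅
    ≡⟨ cong (fromℕ (n C k) *_) (Z₀≡subsetSumProb∅ G p) ⟨
  fromℕ (n C k) * Z G p 0 ∎
  where
  open ℚ.≤-Reasoning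
  P : Subset n → ℚ
  P = subsetSumProb p incidence (edges G)
  P≤P∅ : ∀ a → P a ≤ P ∅
  P≤P∅ = subsetSumProb≤subsetSumProb∅ p 0≤p p≤½ incidence (edges G)

-- Opened only here: the constructor +_ would make sections such as (x +_) ambiguous above.
open import Data.Integer using (+_)

lemmaB1 : (n : ℕ) (G : Graph n) (p : ℚ) → 0ℚ < p → p ≤ ½ →
          Z G p 2 ≤ ((+ (n C 2)) / 1) * Z G p 0
lemmaB1 n G p 0<p p≤½ = Z≤nCk*Z₀ n G p (ℚ.<⇒≤ 0<p) p≤½ 2
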